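{- For every $n \ge 2$, $$t(n) = t^o(n) + t^i(n) = n\, t^o(n-1).$$
   Context: Stamp foldings. Fix $n\ge 1$. A strip of $n$ stamps labeled $1,\dots,n$, with consecutive stamps $k,k+1$ joined by a perforation, is folded into a stack one stamp wide. A folding is recorded as the permutation $f$ of $\{1,\dots,n\}$ with $f(i)$ the label of the stamp at position $i$ from the top. Let $\pi=f^{ -1}$, so $\pi(k)$ is the position of stamp $k$. The permutation $f$ is a folding iff for all $1\le k<l\le n-1$ with $k\equiv l \pmod 2$ it is not the case that exactly one of $\pi(l),\pi(l+1)$ lies strictly between $\pi(k)$ and $\pi(k+1)$. Geometrically, the perforations between stamps $k,k+1$ with $k$ odd lie on one side of the stack and those with $k$ even on the other, and perforations on the same side do not cross. $\mathcal{T}_n$ is the set of foldings of $n$ stamps and $t(n)=|\mathcal{T}_n|$. Leaf $n$ is "out" if there is no $k\in\{1,\dots,n-2\}$ with $k\equiv n \pmod 2$ such that $\pi(n)$ lies strictly between $\pi(k)$ and $\pi(k+1)$. That is, the free end of stamp $n$ is not enclosed by a perforation on its side. Otherwise leaf $n$ is "in". $t^o(n)$ is the number of foldings in $\mathcal{T}_n$ with leaf $n$ out, and $t^i(n)$ is the number with leaf $n$ in. -}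

module Defs where

open import Data.Nat using (ℕ; zero; suc; _+_; _*_; _∸_; _≡ᵇ_; _<ᵇ_)
open import Data.Nat.DivMod using (_%_)
open import Data.Bool using (Bool; true; false; _∧_; _∨_; not; _xor_)
open import Data.List using (List; []; _∷_; map; concatMap; applyUpTo; length; filterᵇ)
open import Data.Bool.ListAction using (all; any)

-- Labels / positions are natural numbers 1..n, exactly as in the paper.

range : ℕ → ℕ → List ℕ
range a b = applyUpTo (λ i → a + i) (suc b ∸ a)

lists : ℕ → List ℕ → List (List ℕ)
lists zero    xs = [] ∷ []
lists (suc m) xs = concatMap (λ x → map (x ∷_) (lists m xs)) xs

distinct : List ℕ → Bool
distinct []       = true
distinct (x ∷ xs) = not (any (x ≡ᵇ_) xs) ∧ distinct xs

-- all permutations f of {1,…,n}, written as the list [f(1), …, f(n)]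
perms : ℕ → List (List ℕ)
perms n = filterᵇ distinct (lists n (range 1 n))

-- π = f⁻¹ : position (1-based) of label k in f
posFrom : ℕ → List ℕ → ℕ → ℕ
posFrom i []       k = 0
posFrom i (x ∷ xs) k with x ≡ᵇ k
... | true  = i
... | false = posFrom (suc i) xs k

π : List ℕ → ℕ → ℕ
π f k = posFrom 1 f k

strictlyBetween : ℕ → ℕ → ℕ → Bool
strictlyBetween x a b = ((a <ᵇ x) ∧ (x <ᵇ b)) ∨ ((b <ᵇ x) ∧ (x <ᵇ a))

sameParity : ℕ → ℕ → Bool
sameParity k l = (k % 2) ≡ᵇ (l % 2)

crosses : List ℕ → ℕ → ℕ → Bool
crosses f k l =
  strictlyBetween (π f l) (π f k) (π f (suc k))
    xor strictlyBetween (π f (suc l)) (π f k) (π f (suc k))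

isFolding : ℕ → List ℕ → Bool
isFolding n f =
  all (λ k → all (λ l → not (sameParity k l) ∨ not (crosses f k l))
                 (range (suc k) (n ∸ 1)))
      (range 1 (n ∸ 1))

leafOut : ℕ → List ℕ → Bool
leafOut n f =
  not (any (λ k → sameParity k n ∧ strictlyBetween (π f n) (π f k) (π f (suc k)))
           (range 1 (n ∸ 2)))

foldings : ℕ → List (List ℕ)
foldings n = filterᵇ (isFolding n) (perms n)

t : ℕ → ℕ
t n = length (foldings n)

tᵒ : ℕ → ℕ
tᵒ n = length (filterᵇ (leafOut n) (foldings n))

tⁱ : ℕ → ℕ
tⁱ n = length (filterᵇ (λ f → not (leafOut n f)) (foldings n))

-- Moving the top stamp of a stack to the bottom rotates the positions cyclically, and whether two
-- perforations cross depends only on the cyclic order of their four ends, so every rotation of a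
-- folding is a folding. A permutation (n + 1) ∷ g is a folding iff g is a folding of n stamps with
-- leaf n out: the new perforation joins leaf n to the top of the stack, so it crosses a perforation on
-- its side exactly when that perforation encloses leaf n. Hence the foldings of n + 1 stamps are the
-- n + 1 distinct rotations of the lists (n + 1) ∷ g, g ranging over the foldings of n stamps with leaf n out.
module Submission where

open import Data.Bool using (Bool; true; false; not; _∧_; _∨_; _xor_; T; T?)
open import Data.Bool.ListAction using (all; any)
open import Data.Bool.Properties using (T-∧; ∨-comm; ∨-identityʳ; ∧-zeroʳ; ∧-identityʳ; xor-identityʳ; not-involutive)
open import Data.Empty using (⊥-elim)
open import Data.List using (List; []; _∷_; _++_; [_]; length; map; filterᵇ; take; drop;
  cartesianProductWith; cartesianProduct; concatMap)
open import Data.List.Properties using (length-filter; length-++; length-map; length-applyUpTo; length-take;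
  take++drop≡id; ++-assoc; ++-identityʳ; ∷-injective)
open import Data.List.Membership.Propositional using (_∈_; _∉_; lose; find)
open import Data.List.Membership.Propositional.Properties using (∈-filter⁺; ∈-filter⁻; ∈-map⁺; ∈-map⁻; ∈-++⁺ʳ;
  ∈-∃++; ∈-applyUpTo⁺; ∈-applyUpTo⁻; ∈-cartesianProductWith⁺; ∈-cartesianProductWith⁻; ∈-cartesianProduct⁺;
  ∈-cartesianProduct⁻)
open import Data.List.Membership.Propositional.Properties.WithK using (unique∧set⇒bag)
import Data.List.Membership.DecPropositional as DecMembership
open import Data.List.Relation.Binary.BagAndSetEquality using (∼bag⇒↭)
open import Data.List.Relation.Binary.Permutation.Propositional using (_↭_; ↭-sym; ↭⇒↭ₛ)
open import Data.List.Relation.Binary.Permutation.Propositional.Properties using (↭-length; ∈-resp-↭; ++-comm)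
open import Data.List.Relation.Binary.Permutation.Setoid.Properties using (Unique-resp-↭)
open import Data.List.Relation.Binary.Subset.Propositional using (_⊆_)
open import Data.List.Relation.Unary.All using ([]; _∷_)
import Data.List.Relation.Unary.All as All
open import Data.List.Relation.Unary.All.Properties using (all⁺; all⁻; ¬Any⇒All¬; All¬⇒¬Any)
open import Data.List.Relation.Unary.Any using (here; there)
import Data.List.Relation.Unary.Any as Any
open import Data.List.Relation.Unary.Any.Properties using (any⁺; any⁻)
open import Data.List.Relation.Unary.AllPairs using ([]; _∷_)
open import Data.List.Relation.Unary.Unique.Propositional using (Unique)
import Data.List.Relation.Unary.Unique.Propositional.Properties as Unique
open import Data.Nat using (ℕ; zero; suc; _+_; _*_; _∸_; _≤_; _<_; z≤n; s≤s; _≡ᵇ_; _<ᵇ_)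
open import Data.Nat.Properties using (_≟_; ≡ᵇ⇒≡; ≡⇒≡ᵇ; ≤-refl; ≤-reflexive; ≤-trans; <⇒≤; <⇒≢; ≤∧≢⇒<;
  m≤n⇒m<n∨m≡n; m≤m+n; m≤n⇒m≤1+n; m∸n≤m; ∸-monoˡ-<; m+[n∸m]≡n; +-cancelˡ-≡; +-suc; +-identityʳ; *-comm;
  suc-injective; 1+n≰n; m≤n⇒m⊓n≡m; <⇒≤pred; ≤-pred; n<1+n; m<n⇒m<1+n)
open import Data.Product using (_×_; _,_; proj₁; proj₂; ∃; uncurry; map₂)
open import Data.Sum using (inj₁; inj₂)
open import Function using (_∘_; _⇔_; mk⇔; Equivalence)
open import Relation.Binary.Definitions using (DecidableEquality)
open import Relation.Binary.PropositionalEquality using (_≡_; _≢_; refl; sym; trans; cong; cong₂; subst; subst₂; setoid;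
  module ≡-Reasoning)
open import Relation.Nullary using (¬_; yes; no)
open import Relation.Nullary.Decidable using (decidable-stable)

open import Defs

open Equivalence using (to; from)

length-cartesianProductWith : ∀ {A B C : Set} (f : A → B → C) xs ys →
  length (cartesianProductWith f xs ys) ≡ length xs * length ys
length-cartesianProductWith f []       ys = refl
length-cartesianProductWith f (x ∷ xs) ys = trans (length-++ (map (f x) ys))
  (cong₂ _+_ (length-map (f x) ys) (length-cartesianProductWith f xs ys))

concatMap-map≡cartesianProductWith : ∀ {A B C : Set} (f : A → B → C) xs ys →
  concatMap (λ x → map (f x) ys) xs ≡ cartesianProductWith f xs ys
concatMap-map≡cartesianProductWith f []       ys = refl
concatMap-map≡cartesianProductWith f (x ∷ xs) ys =
  cong (map (f x) ys ++_) (concatMap-map≡cartesianProductWith f xs ys)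

take-length-++ : ∀ {A : Set} (xs ys : List A) → take (length xs) (xs ++ ys) ≡ xs
take-length-++ []       ys = refl
take-length-++ (x ∷ xs) ys = cong (x ∷_) (take-length-++ xs ys)

drop-length-++ : ∀ {A : Set} (xs ys : List A) → drop (length xs) (xs ++ ys) ≡ ys
drop-length-++ []       ys = refl
drop-length-++ (x ∷ xs) ys = drop-length-++ xs ys

∉-drop : ∀ {A : Set} {x : A} i xs → x ∉ xs → x ∉ drop i xs
∉-drop i xs x∉xs = x∉xs ∘ subst (_ ∈_) (take++drop≡id i xs) ∘ ∈-++⁺ʳ (take i xs)

++-∷-cancel : ∀ {A : Set} {x : A} as {bs} cs {ds} → x ∉ as → x ∉ cs →
  as ++ x ∷ bs ≡ cs ++ x ∷ ds → as ≡ cs × bs ≡ ds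
++-∷-cancel []       []       _     _     refl = refl , refl
++-∷-cancel []       (c ∷ cs) _     x∉cs  refl = ⊥-elim (x∉cs (here refl))
++-∷-cancel (a ∷ as) []       x∉as  _     refl = ⊥-elim (x∉as (here refl))
++-∷-cancel (a ∷ as) (c ∷ cs) x∉as  x∉cs  eq with ∷-injective eq
... | refl , eq′ with ++-∷-cancel as cs (x∉as ∘ there) (x∉cs ∘ there) eq′
... | refl , refl = refl , refl

∈-filterᵇ⇔ : ∀ {A : Set} {p : A → Bool} {xs x} → x ∈ filterᵇ p xs ⇔ (x ∈ xs × T (p x))
∈-filterᵇ⇔ {p = p} {xs} = mk⇔ (∈-filter⁻ (T? ∘ p) {xs = xs}) (uncurry (∈-filter⁺ (T? ∘ p)))

length-filterᵇ-not : ∀ {A : Set} (p : A → Bool) xs →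
  length (filterᵇ p xs) + length (filterᵇ (not ∘ p) xs) ≡ length xs
length-filterᵇ-not p []       = refl
length-filterᵇ-not p (x ∷ xs) with p x
... | true  = cong suc (length-filterᵇ-not p xs)
... | false = trans (+-suc (length (filterᵇ p xs)) _) (cong suc (length-filterᵇ-not p xs))

Unique-map-injectiveOn : ∀ {A B : Set} {f : A → B} {xs} →
  (∀ {x y} → x ∈ xs → y ∈ xs → f x ≡ f y → x ≡ y) → Unique xs → Unique (map f xs)
Unique-map-injectiveOn {xs = []}             inj []           = []
Unique-map-injectiveOn {f = f} {xs = x ∷ xs} inj (x∉xs ∷ uxs) =
  All.tabulate fresh ∷ Unique-map-injectiveOn (λ p q → inj (there p) (there q)) uxs
  where
  fresh : ∀ {z} → z ∈ map f xs → f x ≢ z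
  fresh z∈ fx≡z with ∈-map⁻ f z∈
  ... | y , y∈xs , refl = All.lookup x∉xs y∈xs (inj (here refl) (there y∈xs) fx≡z)

length-≡-∼set : ∀ {A : Set} {xs ys : List A} → Unique xs → Unique ys →
  (∀ {x} → x ∈ xs ⇔ x ∈ ys) → length xs ≡ length ys
length-≡-∼set uxs uys xs∼ys = ↭-length (∼bag⇒↭ (unique∧set⇒bag uxs uys xs∼ys))

length-mono-⊆ : ∀ {A : Set} → DecidableEquality A →
  ∀ {xs ys : List A} → Unique xs → Unique ys → xs ⊆ ys → length xs ≤ length ys
length-mono-⊆ _≟ᴬ_ {xs} {ys} uxs uys xs⊆ys = ≤-trans
  (≤-reflexive (length-≡-∼set uxs (Unique.filter⁺ (_∈? xs) uys)
    (mk⇔ (λ x∈xs → ∈-filter⁺ (_∈? xs) (xs⊆ys x∈xs) x∈xs) (proj₂ ∘ ∈-filter⁻ (_∈? xs) {xs = ys}))))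
  (length-filter (_∈? xs) ys)
  where open DecMembership _≟ᴬ_ using (_∈?_)

private
  +-≤-of-<-∸ : ∀ a b i → i < suc b ∸ a → a + i ≤ b
  +-≤-of-<-∸ zero          b       i (s≤s i≤b) = i≤b
  +-≤-of-<-∸ (suc a)       (suc b) i i<        = s≤s (+-≤-of-<-∸ a b i i<)
  +-≤-of-<-∸ (suc zero)    zero    i ()
  +-≤-of-<-∸ (suc (suc a)) zero    i ()

∈-range⁻ : ∀ {a b x} → x ∈ range a b → a ≤ x × x ≤ b
∈-range⁻ {a} {b} x∈ with i , i< , refl ← ∈-applyUpTo⁻ (a +_) x∈ = m≤m+n a i , +-≤-of-<-∸ a b i i<

∈-range⁺ : ∀ {a b x} → a ≤ x → x ≤ b → x ∈ range a b
∈-range⁺ {a} {b} {x} a≤x x≤b =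
  subst (_∈ range a b) (m+[n∸m]≡n a≤x) (∈-applyUpTo⁺ (a +_) (∸-monoˡ-< (s≤s x≤b) a≤x))

range-unique : ∀ a b → Unique (range a b)
range-unique a b = Unique.applyUpTo⁺₁ (a +_) _ (λ i<j _ → <⇒≢ i<j ∘ +-cancelˡ-≡ a _ _)

length-range : ∀ a b → length (range a b) ≡ suc b ∸ a
length-range a b = length-applyUpTo (a +_) (suc b ∸ a)

T-not⇔¬T : ∀ {b} → T (not b) ⇔ (¬ T b)
T-not⇔¬T {true}  = mk⇔ (λ ()) (λ ¬t → ¬t _)
T-not⇔¬T {false} = mk⇔ (λ _ ()) (λ _ → _)

T-not∨not⇔ : ∀ {a b} → T (not a ∨ not b) ⇔ (T a → ¬ T b)
T-not∨not⇔ {true}  {true}  = mk⇔ (λ ()) (λ h → h _ _)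
T-not∨not⇔ {true}  {false} = mk⇔ (λ _ _ ()) (λ _ → _)
T-not∨not⇔ {false}         = mk⇔ (λ _ ()) (λ _ → _)

not-xor-not : ∀ x y → not x xor not y ≡ x xor y
not-xor-not true  y = refl
not-xor-not false y = not-involutive y

<ᵇ-true : ∀ {m n} → m < n → (m <ᵇ n) ≡ true
<ᵇ-true {zero}  (s≤s _)   = refl
<ᵇ-true {suc m} (s≤s m<n) = <ᵇ-true m<n

<ᵇ-false : ∀ {m n} → m ≤ n → (n <ᵇ m) ≡ false
<ᵇ-false z≤n       = refl
<ᵇ-false (s≤s m≤n) = <ᵇ-false m≤n

<ᵇ-flip : ∀ {m n} → m ≢ n → (n <ᵇ m) ≡ not (m <ᵇ n)
<ᵇ-flip {zero}  {zero}  m≢n = ⊥-elim (m≢n refl)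
<ᵇ-flip {zero}  {suc n} m≢n = refl
<ᵇ-flip {suc m} {zero}  m≢n = refl
<ᵇ-flip {suc m} {suc n} m≢n = <ᵇ-flip (m≢n ∘ cong suc)

sameParity-suc : ∀ k → ¬ T (sameParity k (suc k))
sameParity-suc zero          ()
sameParity-suc (suc zero)    ()
sameParity-suc (suc (suc k)) = sameParity-suc k

sameParity⇒suc≢ : ∀ {k l} → T (sameParity k l) → suc k ≢ l
sameParity⇒suc≢ {k} par refl = sameParity-suc k par

∈-∷-≢ : ∀ {A : Set} {x k : A} {xs} → x ≢ k → k ∈ x ∷ xs → k ∈ xs
∈-∷-≢ x≢k (here k≡x)  = ⊥-elim (x≢k (sym k≡x))
∈-∷-≢ x≢k (there k∈)  = k∈

posFrom-head : ∀ i x xs → posFrom i (x ∷ xs) x ≡ i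
posFrom-head i x xs with x ≡ᵇ x in eq
... | true  = refl
... | false = ⊥-elim (subst T eq (≡⇒≡ᵇ x x refl))

posFrom-∷ : ∀ i {x k} xs → x ≢ k → posFrom i (x ∷ xs) k ≡ posFrom (suc i) xs k
posFrom-∷ i {x} {k} xs x≢k with x ≡ᵇ k in eq
... | true  = ⊥-elim (x≢k (≡ᵇ⇒≡ x k (subst T (sym eq) _)))
... | false = refl

posFrom-suc : ∀ i {k} xs → k ∈ xs → posFrom (suc i) xs k ≡ suc (posFrom i xs k)
posFrom-suc i {k} (x ∷ xs) k∈ with x ≟ k
... | yes refl = trans (posFrom-head (suc i) x xs) (cong suc (sym (posFrom-head i x xs)))
... | no x≢k   = begin
  posFrom (suc i) (x ∷ xs) k  ≡⟨ posFrom-∷ (suc i) xs x≢k ⟩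
  posFrom (suc (suc i)) xs k  ≡⟨ posFrom-suc (suc i) xs (∈-∷-≢ x≢k k∈) ⟩
  suc (posFrom (suc i) xs k)  ≡⟨ cong suc (posFrom-∷ i xs x≢k) ⟨
  suc (posFrom i (x ∷ xs) k)  ∎
  where open ≡-Reasoning

π-head : ∀ x xs → π (x ∷ xs) x ≡ 1
π-head = posFrom-head 1

π-∷ : ∀ {x k} xs → x ≢ k → k ∈ xs → π (x ∷ xs) k ≡ suc (π xs k)
π-∷ xs x≢k k∈ = trans (posFrom-∷ 1 xs x≢k) (posFrom-suc 1 xs k∈)

π-bounds : ∀ {k} xs → k ∈ xs → 1 ≤ π xs k × π xs k ≤ length xs
π-bounds {k} (x ∷ xs) k∈ with x ≟ k
... | yes refl = subst (λ p → 1 ≤ p × p ≤ suc (length xs)) (sym (π-head x xs)) (≤-refl , s≤s z≤n)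
... | no x≢k   = subst (λ p → 1 ≤ p × p ≤ suc (length xs)) (sym (π-∷ xs x≢k k∈xs)) (s≤s z≤n , s≤s p≤)
  where
  k∈xs = ∈-∷-≢ x≢k k∈
  p≤ = proj₂ (π-bounds xs k∈xs)

π-∷-≢1 : ∀ {x k} xs → x ≢ k → k ∈ xs → π (x ∷ xs) k ≢ 1
π-∷-≢1 xs x≢k k∈ e = <⇒≢ (proj₁ (π-bounds xs k∈)) (sym (suc-injective (trans (sym (π-∷ xs x≢k k∈)) e)))

π-injective : ∀ {k k′} xs → k ∈ xs → k′ ∈ xs → π xs k ≡ π xs k′ → k ≡ k′
π-injective {k} {k′} (x ∷ xs) k∈ k′∈ eq with x ≟ k | x ≟ k′
... | yes refl | yes refl = refl
... | yes refl | no x≢k′  = ⊥-elim (π-∷-≢1 xs x≢k′ (∈-∷-≢ x≢k′ k′∈) (trans (sym eq) (π-head x xs)))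
... | no x≢k   | yes refl = ⊥-elim (π-∷-≢1 xs x≢k (∈-∷-≢ x≢k k∈) (trans eq (π-head x xs)))
... | no x≢k   | no x≢k′  = π-injective xs k∈xs k′∈xs
  (suc-injective (trans (sym (π-∷ xs x≢k k∈xs)) (trans eq (π-∷ xs x≢k′ k′∈xs))))
  where
  k∈xs  = ∈-∷-≢ x≢k k∈
  k′∈xs = ∈-∷-≢ x≢k′ k′∈

posFrom-++ˡ : ∀ i {k} xs ys → k ∈ xs → posFrom i (xs ++ ys) k ≡ posFrom i xs k
posFrom-++ˡ i {k} (x ∷ xs) ys k∈ with x ≟ k
... | yes refl = trans (posFrom-head i x (xs ++ ys)) (sym (posFrom-head i x xs))
... | no x≢k   = trans (posFrom-∷ i (xs ++ ys) x≢k)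
  (trans (posFrom-++ˡ (suc i) xs ys (∈-∷-≢ x≢k k∈)) (sym (posFrom-∷ i xs x≢k)))

posFrom-last : ∀ i {x} xs → x ∉ xs → posFrom i (xs ++ [ x ]) x ≡ i + length xs
posFrom-last i {x} []       _    = trans (posFrom-head i x []) (sym (+-identityʳ i))
posFrom-last i {x} (y ∷ xs) x∉ =
  trans (posFrom-∷ i {y} (xs ++ [ x ]) (λ { refl → x∉ (here refl) }))
        (trans (posFrom-last (suc i) xs (x∉ ∘ there)) (sym (+-suc i (length xs))))

π-++ˡ : ∀ {k} xs ys → k ∈ xs → π (xs ++ ys) k ≡ π xs k
π-++ˡ = posFrom-++ˡ 1

π-last : ∀ {x} xs → x ∉ xs → π (xs ++ [ x ]) x ≡ suc (length xs)
π-last = posFrom-last 1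

-- Crossing chords

-- crosses f k l unfolds to separates (π f k) (π f (suc k)) (π f l) (π f (suc l)).
separates : ℕ → ℕ → ℕ → ℕ → Bool
separates a b c d = strictlyBetween c a b xor strictlyBetween d a b

strictlyBetween-swap : ∀ x a b → strictlyBetween x a b ≡ strictlyBetween x b a
strictlyBetween-swap x a b = ∨-comm ((a <ᵇ x) ∧ (x <ᵇ b)) ((b <ᵇ x) ∧ (x <ᵇ a))

separates-swap : ∀ a b c d → separates a b c d ≡ separates b a c d
separates-swap a b c d = cong₂ _xor_ (strictlyBetween-swap c a b) (strictlyBetween-swap d a b)

separates-shift : ∀ {a b c d a′ b′ c′ d′} → a ≡ suc a′ → b ≡ suc b′ → c ≡ suc c′ → d ≡ suc d′ →
  separates a b c d ≡ separates a′ b′ c′ d′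
separates-shift refl refl refl refl = refl

separates-top : ∀ {a b c d a′ b′ c′} → a ≡ suc a′ → b ≡ suc b′ → c ≡ suc c′ → d ≡ 1 →
  separates a b c d ≡ strictlyBetween c′ a′ b′
separates-top refl refl refl refl = xor-identityʳ _

-- Rotated N p p′: moving the top stamp of a stack of height N to the bottom moves position p to p′.
data Rotated (N : ℕ) : ℕ → ℕ → Set where
  lower : ∀ {p} → suc p < N → Rotated N (suc (suc p)) (suc p)
  top   : Rotated N 1 N

strictlyBetween-bottom : ∀ {N α β} → suc α < N → suc β < N → strictlyBetween N (suc α) (suc β) ≡ false
strictlyBetween-bottom α< β< rewrite <ᵇ-true α< | <ᵇ-false (<⇒≤ β<) | <ᵇ-true β< | <ᵇ-false (<⇒≤ α<) = refl

strictlyBetween-fromTop : ∀ γ β → strictlyBetween (suc (suc γ)) 1 (suc (suc β)) ≡ (γ <ᵇ β)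
strictlyBetween-fromTop γ β = trans (cong ((γ <ᵇ β) ∨_) (∧-zeroʳ (β <ᵇ γ))) (∨-identityʳ _)

strictlyBetween-fromBottom : ∀ {N γ β} → suc γ < N → suc β < N →
  strictlyBetween (suc γ) N (suc β) ≡ (β <ᵇ γ)
strictlyBetween-fromBottom γ< β< rewrite <ᵇ-false (<⇒≤ γ<) | <ᵇ-true γ< = ∧-identityʳ _

-- Moving the endpoint of a chord from the top to the bottom flips which of the other points it encloses.
separates-fromTop : ∀ {N β γ δ} → suc β < N → suc γ < N → suc δ < N → γ ≢ β → δ ≢ β →
  separates N (suc β) (suc γ) (suc δ) ≡ separates 1 (suc (suc β)) (suc (suc γ)) (suc (suc δ))
separates-fromTop {N} {β} {γ} {δ} β< γ< δ< γ≢β δ≢β = begin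
  separates N (suc β) (suc γ) (suc δ)
    ≡⟨ cong₂ _xor_ (strictlyBetween-fromBottom γ< β<) (strictlyBetween-fromBottom δ< β<) ⟩
  (β <ᵇ γ) xor (β <ᵇ δ)            ≡⟨ cong₂ _xor_ (<ᵇ-flip γ≢β) (<ᵇ-flip δ≢β) ⟩
  not (γ <ᵇ β) xor not (δ <ᵇ β)    ≡⟨ not-xor-not (γ <ᵇ β) (δ <ᵇ β) ⟩
  (γ <ᵇ β) xor (δ <ᵇ β)
    ≡⟨ cong₂ _xor_ (strictlyBetween-fromTop γ β) (strictlyBetween-fromTop δ β) ⟨
  separates 1 (suc (suc β)) (suc (suc γ)) (suc (suc δ)) ∎
  where open ≡-Reasoning

separates-rotated : ∀ {N a b c d a′ b′ c′ d′} →
  Rotated N a a′ → Rotated N b b′ → Rotated N c c′ → Rotated N d d′ →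
  a ≢ b → a ≢ c → a ≢ d → b ≢ c → b ≢ d → c ≢ d →
  separates a′ b′ c′ d′ ≡ separates a b c d
separates-rotated (lower _) (lower _) (lower _) (lower _) _ _ _ _ _ _ = refl
separates-rotated top (lower β<) (lower γ<) (lower δ<) _ _ _ b≢c b≢d _ =
  separates-fromTop β< γ< δ< (b≢c ∘ cong (2 +_) ∘ sym) (b≢d ∘ cong (2 +_) ∘ sym)
separates-rotated {N} (lower {α} α<) top (lower {γ} γ<) (lower {δ} δ<) _ a≢c a≢d _ _ _ = begin
  separates (suc α) N (suc γ) (suc δ)  ≡⟨ separates-swap (suc α) N (suc γ) (suc δ) ⟩
  separates N (suc α) (suc γ) (suc δ)
    ≡⟨ separates-fromTop α< γ< δ< (a≢c ∘ cong (2 +_) ∘ sym) (a≢d ∘ cong (2 +_) ∘ sym) ⟩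
  separates 1 (2 + α) (2 + γ) (2 + δ)  ≡⟨ separates-swap 1 (2 + α) (2 + γ) (2 + δ) ⟩
  separates (2 + α) 1 (2 + γ) (2 + δ)  ∎
  where open ≡-Reasoning
separates-rotated {N} (lower {α} α<) (lower {β} β<) top (lower {δ} _) _ _ _ _ _ _ =
  cong (_xor strictlyBetween (suc δ) (suc α) (suc β)) (strictlyBetween-bottom α< β<)
separates-rotated {N} (lower {α} α<) (lower {β} β<) (lower {γ} _) top _ _ _ _ _ _ =
  cong (strictlyBetween (suc γ) (suc α) (suc β) xor_) (strictlyBetween-bottom α< β<)
separates-rotated top top _   _   a≢b _   _   _   _   _   = ⊥-elim (a≢b refl)
separates-rotated top _   top _   _   a≢c _   _   _   _   = ⊥-elim (a≢c refl)
separates-rotated top _   _   top _   _   a≢d _   _   _   = ⊥-elim (a≢d refl)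
separates-rotated _   top top _   _   _   _   b≢c _   _   = ⊥-elim (b≢c refl)
separates-rotated _   top _   top _   _   _   _   b≢d _   = ⊥-elim (b≢d refl)
separates-rotated _   _   top top _   _   _   _   _   c≢d = ⊥-elim (c≢d refl)

π-rotate : ∀ {x s} xs → x ∉ xs → s ∈ x ∷ xs → Rotated (suc (length xs)) (π (x ∷ xs) s) (π (xs ++ [ x ]) s)
π-rotate {x} {s} xs x∉xs s∈ with x ≟ s
... | yes refl = subst₂ (Rotated _) (sym (π-head x xs)) (sym (π-last xs x∉xs)) top
... | no x≢s   = subst₂ (Rotated _) (sym (π-∷ xs x≢s s∈xs)) (sym (π-++ˡ xs [ x ] s∈xs))
                   (lowerAt (π-bounds xs s∈xs))
  where
  s∈xs = ∈-∷-≢ x≢s s∈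
  lowerAt : ∀ {p} → 1 ≤ p × p ≤ length xs → Rotated (suc (length xs)) (suc p) p
  lowerAt {suc p} (_ , p≤) = lower (s≤s p≤)

record IsPermutation (n : ℕ) (f : List ℕ) : Set where
  field
    length≡ : length f ≡ n
    bounded : ∀ {x} → x ∈ f → 1 ≤ x × x ≤ n
    unique  : Unique f

  ⊆-range : f ⊆ range 1 n
  ⊆-range x∈ = uncurry ∈-range⁺ (bounded x∈)

  complete : ∀ {x} → 1 ≤ x → x ≤ n → x ∈ f
  complete {x} 1≤x x≤n = decidable-stable (x ∈? f) λ x∉f →
    1+n≰n (subst (suc (length f) ≤_) (trans (length-range 1 n) (sym length≡))
      (length-mono-⊆ _≟_ (¬Any⇒All¬ f x∉f ∷ unique) (range-unique 1 n)
        λ { (here refl) → ∈-range⁺ 1≤x x≤n ; (there y∈) → ⊆-range y∈ }))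
    where open DecMembership _≟_ using (_∈?_)

  ∉-suc : suc n ∉ f
  ∉-suc = 1+n≰n ∘ proj₂ ∘ bounded

open IsPermutation

IsPermutation-resp-↭ : ∀ {n xs ys} → xs ↭ ys → IsPermutation n xs → IsPermutation n ys
IsPermutation-resp-↭ xs↭ys P = record
  { length≡ = trans (sym (↭-length xs↭ys)) (length≡ P)
  ; bounded = bounded P ∘ ∈-resp-↭ (↭-sym xs↭ys)
  ; unique  = Unique-resp-↭ (setoid ℕ) (↭⇒↭ₛ xs↭ys) (unique P)
  }

IsPermutation-top⁺ : ∀ {m g} → IsPermutation m g → IsPermutation (suc m) (suc m ∷ g)
IsPermutation-top⁺ {m} P = record
  { length≡ = cong suc (length≡ P)
  ; bounded = λ { (here refl) → s≤s z≤n , ≤-refl ; (there x∈) → map₂ m≤n⇒m≤1+n (bounded P x∈) }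
  ; unique  = ¬Any⇒All¬ _ (∉-suc P) ∷ unique P
  }

IsPermutation-top⁻ : ∀ {m g} → IsPermutation (suc m) (suc m ∷ g) → IsPermutation m g
IsPermutation-top⁻ {m} {g} P with unique P
... | m+1∉g ∷ ug = record
  { length≡ = suc-injective (length≡ P)
  ; bounded = λ x∈ → map₂ (λ x≤ → ≤-pred (≤∧≢⇒< x≤ (All.lookup m+1∉g x∈ ∘ sym))) (bounded P (there x∈))
  ; unique  = ug
  }

lists-suc : ∀ m xs → lists (suc m) xs ≡ cartesianProductWith _∷_ xs (lists m xs)
lists-suc m xs = concatMap-map≡cartesianProductWith _∷_ xs (lists m xs)

∈-lists⁺ : ∀ {m xs f} → length f ≡ m → f ⊆ xs → f ∈ lists m xs
∈-lists⁺ {zero}      {f = []}    refl _   = here refl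
∈-lists⁺ {suc m} {xs} {f = x ∷ f} refl f⊆ = subst (x ∷ f ∈_) (sym (lists-suc m xs))
  (∈-cartesianProductWith⁺ _∷_ (f⊆ (here refl)) (∈-lists⁺ refl (f⊆ ∘ there)))

∈-lists⁻ : ∀ {m xs f} → f ∈ lists m xs → length f ≡ m × f ⊆ xs
∈-lists⁻ {zero}      (here refl) = refl , λ ()
∈-lists⁻ {suc m} {xs} f∈
  with x , l , x∈ , l∈ , refl ← ∈-cartesianProductWith⁻ _∷_ xs (lists m xs) (subst (_ ∈_) (lists-suc m xs) f∈)
  with l≡ , l⊆ ← ∈-lists⁻ l∈
  = cong suc l≡ , λ { (here refl) → x∈ ; (there y∈) → l⊆ y∈ }

lists-unique : ∀ m {xs} → Unique xs → Unique (lists m xs)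
lists-unique zero    uxs = [] ∷ []
lists-unique (suc m) {xs} uxs = subst Unique (sym (lists-suc m xs))
  (Unique.cartesianProductWith⁺ _∷_ ∷-injective uxs (lists-unique m uxs))

T-any-≡ᵇ⇔ : ∀ {x xs} → T (any (x ≡ᵇ_) xs) ⇔ x ∈ xs
T-any-≡ᵇ⇔ {x} {xs} = mk⇔ (Any.map (≡ᵇ⇒≡ x _) ∘ any⁻ _ xs) (any⁺ _ ∘ Any.map (≡⇒≡ᵇ x _))

T-distinct⇔ : ∀ {xs} → T (distinct xs) ⇔ Unique xs
T-distinct⇔ {[]}     = mk⇔ (λ _ → []) (λ _ → _)
T-distinct⇔ {x ∷ xs} = mk⇔
  (λ t → let fresh , rest = to T-∧ t in
    ¬Any⇒All¬ xs (to T-not⇔¬T fresh ∘ from T-any-≡ᵇ⇔) ∷ to T-distinct⇔ rest)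
  (λ { (x∉ ∷ uxs) → from T-∧ (from T-not⇔¬T (All¬⇒¬Any x∉ ∘ to T-any-≡ᵇ⇔) , from T-distinct⇔ uxs) })

∈-perms⇔ : ∀ {n f} → f ∈ perms n ⇔ IsPermutation n f
∈-perms⇔ {n} = mk⇔
  (λ f∈ → let f∈lists , t = to ∈-filterᵇ⇔ f∈ ; f≡ , f⊆ = ∈-lists⁻ f∈lists in
    record { length≡ = f≡ ; bounded = ∈-range⁻ ∘ f⊆ ; unique = to T-distinct⇔ t })
  (λ P → from ∈-filterᵇ⇔ (∈-lists⁺ (length≡ P) (⊆-range P) , from T-distinct⇔ (unique P)))

-- Foldings

NonCrossing : ℕ → List ℕ → Set
NonCrossing n f = ∀ k l → 1 ≤ k → k < l → l ≤ n ∸ 1 → T (sameParity k l) → ¬ T (crosses f k l)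

LeafOut : ℕ → List ℕ → Set
LeafOut n f = ∀ k → 1 ≤ k → k ≤ n ∸ 2 → T (sameParity k n) →
  ¬ T (strictlyBetween (π f n) (π f k) (π f (suc k)))

Folding : ℕ → List ℕ → Set
Folding n f = IsPermutation n f × NonCrossing n f

T-isFolding⇔ : ∀ {n f} → T (isFolding n f) ⇔ NonCrossing n f
T-isFolding⇔ {n} {f} = mk⇔
  (λ t k l 1≤k k<l l≤ → to T-not∨not⇔ (All.lookup
     (all⁺ (noCrossingWith k) (range (suc k) (n ∸ 1))
       (All.lookup (all⁺ noCrossingFrom (range 1 (n ∸ 1)) t) (∈-range⁺ 1≤k (≤-trans (<⇒≤ k<l) l≤))))
     (∈-range⁺ k<l l≤)))
  (λ nc → all⁻ noCrossingFrom (All.tabulate λ {k} k∈ → all⁻ (noCrossingWith k) (All.tabulate λ l∈ →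
     from T-not∨not⇔ (nc _ _ (proj₁ (∈-range⁻ {b = n ∸ 1} k∈)) (proj₁ (∈-range⁻ l∈)) (proj₂ (∈-range⁻ l∈))))))
  where
  noCrossingWith : ℕ → ℕ → Bool
  noCrossingWith k l = not (sameParity k l) ∨ not (crosses f k l)
  noCrossingFrom : ℕ → Bool
  noCrossingFrom k = all (noCrossingWith k) (range (suc k) (n ∸ 1))

T-leafOut⇔ : ∀ {n f} → T (leafOut n f) ⇔ LeafOut n f
T-leafOut⇔ {n} {f} = mk⇔
  (λ t k 1≤k k≤ sp sb → to T-not⇔¬T t (any⁺ enclosedBy (lose (∈-range⁺ 1≤k k≤) (from T-∧ (sp , sb)))))
  (λ lo → from T-not⇔¬T λ t →
    let k , k∈ , tk = find (any⁻ enclosedBy (range 1 (n ∸ 2)) t)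
        sp , sb     = to T-∧ tk
        1≤k , k≤    = ∈-range⁻ {b = n ∸ 2} k∈
    in lo k 1≤k k≤ sp sb)
  where
  enclosedBy : ℕ → Bool
  enclosedBy k = sameParity k n ∧ strictlyBetween (π f n) (π f k) (π f (suc k))

∈-foldings⇔ : ∀ {n f} → f ∈ foldings n ⇔ Folding n f
∈-foldings⇔ {n} {f} = mk⇔
  (λ f∈ → let f∈perms , t = to ∈-filterᵇ⇔ f∈ in to ∈-perms⇔ f∈perms , to (T-isFolding⇔ {n} {f}) t)
  (λ (P , nc) → from ∈-filterᵇ⇔ (from ∈-perms⇔ P , from (T-isFolding⇔ {n} {f}) nc))

foldings-unique : ∀ n → Unique (foldings n)
foldings-unique n = Unique.filter⁺ (T? ∘ isFolding n)
  (Unique.filter⁺ (T? ∘ distinct) (lists-unique n (range-unique 1 n)))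

leafOutFoldings : ℕ → List (List ℕ)
leafOutFoldings m = filterᵇ (leafOut m) (foldings m)

∈-leafOutFoldings⇔ : ∀ {m g} → g ∈ leafOutFoldings m ⇔ (Folding m g × LeafOut m g)
∈-leafOutFoldings⇔ {m} {g} = mk⇔
  (λ g∈ → let g∈foldings , t = to ∈-filterᵇ⇔ g∈ in to ∈-foldings⇔ g∈foldings , to (T-leafOut⇔ {m} {g}) t)
  (λ (φ , lo) → from ∈-filterᵇ⇔ (from ∈-foldings⇔ φ , from (T-leafOut⇔ {m} {g}) lo))

leafOutFoldings-unique : ∀ m → Unique (leafOutFoldings m)
leafOutFoldings-unique m = Unique.filter⁺ (T? ∘ leafOut m) (foldings-unique m)

crossingLabels : ∀ {n f k l} → IsPermutation n f → 1 ≤ k → k < l → l ≤ n ∸ 1 →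
  k ∈ f × suc k ∈ f × l ∈ f × suc l ∈ f
crossingLabels {suc n} P 1≤k k<l l≤n =
  complete P 1≤k (≤-trans (<⇒≤ k<l) (m≤n⇒m≤1+n l≤n)) , complete P (s≤s z≤n) (≤-trans k<l (m≤n⇒m≤1+n l≤n)) ,
  complete P (≤-trans 1≤k (<⇒≤ k<l)) (m≤n⇒m≤1+n l≤n) , complete P (s≤s z≤n) (s≤s l≤n)
crossingLabels {zero} P 1≤k () z≤n

NonCrossing-rotate₁ : ∀ {n x} xs → IsPermutation n (x ∷ xs) → NonCrossing n (x ∷ xs) → NonCrossing n (xs ++ [ x ])
NonCrossing-rotate₁ {n} {x} xs P nc k l 1≤k k<l l≤ par
  with k∈ , sk∈ , l∈ , sl∈ ← crossingLabels P 1≤k k<l l≤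
  with x∉xs ∷ _ ← unique P
  = nc k l 1≤k k<l l≤ par ∘ subst T (separates-rotated (ρ k∈) (ρ sk∈) (ρ l∈) (ρ sl∈)
      (apart k∈ sk∈ (<⇒≢ (n<1+n k)))      (apart k∈ l∈ (<⇒≢ k<l))
      (apart k∈ sl∈ (<⇒≢ (m<n⇒m<1+n k<l))) (apart sk∈ l∈ (sameParity⇒suc≢ par))
      (apart sk∈ sl∈ (<⇒≢ (s≤s k<l)))      (apart l∈ sl∈ (<⇒≢ (n<1+n l))))
  where
  ρ : ∀ {s} → s ∈ x ∷ xs → Rotated (suc (length xs)) (π (x ∷ xs) s) (π (xs ++ [ x ]) s)
  ρ = π-rotate xs (All¬⇒¬Any x∉xs)
  apart : ∀ {a b} → a ∈ x ∷ xs → b ∈ x ∷ xs → a ≢ b → π (x ∷ xs) a ≢ π (x ∷ xs) b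
  apart a∈ b∈ a≢b = a≢b ∘ π-injective (x ∷ xs) a∈ b∈

Folding-rotate : ∀ {n} xs {ys} → Folding n (xs ++ ys) → Folding n (ys ++ xs)
Folding-rotate {n} []       {ys} φ = subst (Folding n) (sym (++-identityʳ ys)) φ
Folding-rotate {n} (x ∷ xs) {ys} (P , nc) = subst (Folding n) (++-assoc ys [ x ] xs)
  (Folding-rotate xs (subst (Folding n) (++-assoc xs ys [ x ])
    (IsPermutation-resp-↭ (++-comm [ x ] (xs ++ ys)) P , NonCrossing-rotate₁ (xs ++ ys) P nc)))

crosses-∷ : ∀ {x k l} g → x ∉ g → k ∈ g → suc k ∈ g → l ∈ g → suc l ∈ g →
  crosses (x ∷ g) k l ≡ crosses g k l
crosses-∷ {x} g x∉g k∈ sk∈ l∈ sl∈ =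
  separates-shift (π-∷ g (x≢ k∈) k∈) (π-∷ g (x≢ sk∈) sk∈) (π-∷ g (x≢ l∈) l∈) (π-∷ g (x≢ sl∈) sl∈)
  where
  x≢ : ∀ {s} → s ∈ g → x ≢ s
  x≢ s∈ refl = x∉g s∈

crosses-top : ∀ {k l} g → suc l ∉ g → k ∈ g → suc k ∈ g → l ∈ g →
  crosses (suc l ∷ g) k l ≡ strictlyBetween (π g l) (π g k) (π g (suc k))
crosses-top {l = l} g x∉g k∈ sk∈ l∈ =
  separates-top (π-∷ g (x≢ k∈) k∈) (π-∷ g (x≢ sk∈) sk∈) (π-∷ g (x≢ l∈) l∈) (π-head (suc l) g)
  where
  x≢ : ∀ {s} → s ∈ g → suc l ≢ s
  x≢ s∈ refl = x∉g s∈

≤∸2⇒2+≤ : ∀ {k n} → 1 ≤ k → k ≤ n ∸ 2 → 2 + k ≤ n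
≤∸2⇒2+≤ {n = suc (suc n)} _ k≤n = s≤s (s≤s k≤n)
≤∸2⇒2+≤ {n = zero}        (s≤s _) ()
≤∸2⇒2+≤ {n = suc zero}    (s≤s _) ()

2+≤⇒≤∸2 : ∀ {k n} → 2 + k ≤ n → k ≤ n ∸ 2
2+≤⇒≤∸2 (s≤s (s≤s k≤n)) = k≤n

Folding-top⁻ : ∀ {m g} → Folding (suc m) (suc m ∷ g) → Folding m g × LeafOut m g
Folding-top⁻ {m} {g} (P , nc) = (Pg , ncg) , lo
  where
  Pg = IsPermutation-top⁻ P
  ncg : NonCrossing m g
  ncg k l 1≤k k<l l≤ par with k∈ , sk∈ , l∈ , sl∈ ← crossingLabels Pg 1≤k k<l l≤ =
    nc k l 1≤k k<l (≤-trans l≤ (m∸n≤m m 1)) par ∘ subst T (sym (crosses-∷ g (∉-suc Pg) k∈ sk∈ l∈ sl∈))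
  lo : LeafOut m g
  lo k 1≤k k≤ par = nc k m 1≤k k<m ≤-refl par ∘ subst T (sym (crosses-top g (∉-suc Pg) k∈ sk∈ m∈))
    where
    2+k≤m = ≤∸2⇒2+≤ 1≤k k≤
    k<m   = <⇒≤ 2+k≤m
    k∈    = complete Pg 1≤k (<⇒≤ k<m)
    sk∈   = complete Pg (s≤s z≤n) k<m
    m∈    = complete Pg (≤-trans 1≤k (<⇒≤ k<m)) ≤-refl

Folding-top⁺ : ∀ {m g} → Folding m g → LeafOut m g → Folding (suc m) (suc m ∷ g)
Folding-top⁺ {m} {g} (Pg , ncg) lo = IsPermutation-top⁺ Pg , nc
  where
  nc : NonCrossing (suc m) (suc m ∷ g)
  nc k l 1≤k k<l l≤m par with m≤n⇒m<n∨m≡n l≤m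
  ... | inj₁ l<m with k∈ , sk∈ , l∈ , sl∈ ← crossingLabels Pg 1≤k k<l (<⇒≤pred l<m) =
    ncg k l 1≤k k<l (<⇒≤pred l<m) par ∘ subst T (crosses-∷ g (∉-suc Pg) k∈ sk∈ l∈ sl∈)
  ... | inj₂ refl = lo k 1≤k (2+≤⇒≤∸2 2+k≤m) par ∘ subst T (crosses-top g (∉-suc Pg) k∈ sk∈ m∈)
    where
    2+k≤m = ≤∧≢⇒< k<l (sameParity⇒suc≢ par)
    k∈    = complete Pg 1≤k (<⇒≤ k<l)
    sk∈   = complete Pg (s≤s z≤n) k<l
    m∈    = complete Pg (≤-trans 1≤k (<⇒≤ k<l)) ≤-refl

-- Counting

insertRotated : ℕ → List ℕ → ℕ → List ℕ
insertRotated x g i = drop i g ++ x ∷ take i g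

insertRotated-injective : ∀ {x g g′ i i′} → x ∉ g → x ∉ g′ → i ≤ length g → i′ ≤ length g′ →
  insertRotated x g i ≡ insertRotated x g′ i′ → g ≡ g′ × i ≡ i′
insertRotated-injective {x} {g} {g′} {i} {i′} x∉g x∉g′ i≤ i′≤ eq
  with drops , takes ← ++-∷-cancel (drop i g) (drop i′ g′) (∉-drop i g x∉g) (∉-drop i′ g′ x∉g′) eq =
  (begin
    g                        ≡⟨ take++drop≡id i g ⟨
    take i g ++ drop i g     ≡⟨ cong₂ _++_ takes drops ⟩
    take i′ g′ ++ drop i′ g′ ≡⟨ take++drop≡id i′ g′ ⟩
    g′                       ∎) ,
  (begin
    i                   ≡⟨ length-take-≤ i≤ ⟨
    length (take i g)   ≡⟨ cong length takes ⟩
    length (take i′ g′) ≡⟨ length-take-≤ i′≤ ⟩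
    i′                  ∎)
  where
  open ≡-Reasoning
  length-take-≤ : ∀ {j h} → j ≤ length h → length (take j h) ≡ j
  length-take-≤ {j} {h} j≤ = trans (length-take j h) (m≤n⇒m⊓n≡m j≤)

Folding-insertRotated : ∀ {m g} i → Folding m g → LeafOut m g → Folding (suc m) (insertRotated (suc m) g i)
Folding-insertRotated {m} {g} i φ lo = Folding-rotate (suc m ∷ take i g)
  (subst (Folding (suc m)) (cong (suc m ∷_) (sym (take++drop≡id i g))) (Folding-top⁺ φ lo))

Folding-decompose : ∀ {m f} → Folding (suc m) f →
  ∃ λ g → ∃ λ i → (Folding m g × LeafOut m g) × i ≤ m × f ≡ insertRotated (suc m) g i
Folding-decompose {m} φ with as , bs , refl ← ∈-∃++ (complete (proj₁ φ) (s≤s z≤n) ≤-refl) =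
  bs ++ as , length bs , ψ ,
  subst (length bs ≤_) (trans (sym (length-++ bs)) (length≡ (proj₁ (proj₁ ψ)))) (m≤m+n _ _) ,
  sym (cong₂ (λ u v → u ++ suc m ∷ v) (drop-length-++ bs as) (take-length-++ bs as))
  where
  ψ = Folding-top⁻ (Folding-rotate as φ)

extensions : ℕ → List (List ℕ)
extensions m = map (uncurry (insertRotated (suc m))) (cartesianProduct (leafOutFoldings m) (range 0 m))

foldings⇔extensions : ∀ {m f} → f ∈ foldings (suc m) ⇔ f ∈ extensions m
foldings⇔extensions {m} = mk⇔
  (λ f∈ → let g , i , ψ , i≤m , f≡ = Folding-decompose (to ∈-foldings⇔ f∈) in
    subst (_∈ extensions m) (sym f≡)
      (∈-map⁺ (uncurry (insertRotated (suc m))) (∈-cartesianProduct⁺ (from ∈-leafOutFoldings⇔ ψ) (∈-range⁺ z≤n i≤m))))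
  (λ f∈ → let (g , i) , gi∈ , f≡ = ∈-map⁻ (uncurry (insertRotated (suc m))) f∈
              g∈ , _ = ∈-cartesianProduct⁻ (leafOutFoldings m) (range 0 m) gi∈ in
    subst (_∈ foldings (suc m)) (sym f≡)
      (from ∈-foldings⇔ (uncurry (Folding-insertRotated i) (to ∈-leafOutFoldings⇔ g∈))))

extensions-unique : ∀ m → Unique (extensions m)
extensions-unique m = Unique-map-injectiveOn injective
  (Unique.cartesianProduct⁺ (leafOutFoldings-unique m) (range-unique 0 m))
  where
  bound : ∀ {g i} → (g , i) ∈ cartesianProduct (leafOutFoldings m) (range 0 m) → suc m ∉ g × i ≤ length g
  bound gi∈ with g∈ , i∈ ← ∈-cartesianProduct⁻ (leafOutFoldings m) (range 0 m) gi∈ =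
    let P = proj₁ (proj₁ (to ∈-leafOutFoldings⇔ g∈)) in
    ∉-suc P , subst (_ ≤_) (sym (length≡ P)) (proj₂ (∈-range⁻ {0} {m} i∈))
  injective : ∀ {p q} → p ∈ cartesianProduct (leafOutFoldings m) (range 0 m) →
    q ∈ cartesianProduct (leafOutFoldings m) (range 0 m) →
    uncurry (insertRotated (suc m)) p ≡ uncurry (insertRotated (suc m)) q → p ≡ q
  injective {_ , _} {_ , _} p∈ q∈ eq with x∉g , i≤ ← bound p∈ | x∉g′ , i′≤ ← bound q∈ =
    uncurry (cong₂ _,_) (insertRotated-injective x∉g x∉g′ i≤ i′≤ eq)

t-suc : ∀ m → t (suc m) ≡ suc m * tᵒ m
t-suc m = begin
  t (suc m)                 ≡⟨ length-≡-∼set (foldings-unique (suc m)) (extensions-unique m) foldings⇔extensions ⟩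
  length (extensions m)     ≡⟨ length-map _ (cartesianProduct (leafOutFoldings m) (range 0 m)) ⟩
  length (cartesianProduct (leafOutFoldings m) (range 0 m))
                            ≡⟨ length-cartesianProductWith _,_ (leafOutFoldings m) (range 0 m) ⟩
  tᵒ m * length (range 0 m) ≡⟨ cong (tᵒ m *_) (length-range 0 m) ⟩
  tᵒ m * suc m              ≡⟨ *-comm (tᵒ m) (suc m) ⟩
  suc m * tᵒ m              ∎
  where open ≡-Reasoning

t-split : ∀ n → t n ≡ tᵒ n + tⁱ n
t-split n = sym (length-filterᵇ-not (leafOut n) (foldings n))

proposition3 : (n : ℕ) → 2 ≤ n → (t n ≡ tᵒ n + tⁱ n) × (tᵒ n + tⁱ n ≡ n * tᵒ (n ∸ 1))
proposition3 (suc m) _ = t-split (suc m) , trans (sym (t-split (suc m))) (t-suc m)
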